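{- Let $F_1,F_2$ be finite processes that are parallel compositions of prefixed finite processes, and let $F_1',F_2'$ be finite processes. If $!F_1|F_1'\sim\ !F_2|F_2'$, then $!F_1\sim\ !F_2$.
   Context: Fix a countable set of actions. Finite processes: $F ::= 0 \mid \alpha.F \mid F|F$. Processes: $P ::= F \mid\ !\alpha.F \mid P|P$. For $F=\alpha_1.G_1|\cdots|\alpha_k.G_k$, $!F$ denotes $!\alpha_1.G_1|\cdots|\,!\alpha_k.G_k$. Transitions: $\alpha.F\xrightarrow{\alpha}F$; $!\alpha.F\xrightarrow{\alpha}\ !\alpha.F|F$; if $P_1\xrightarrow{\alpha}P_1'$ then $P_1|P_2\xrightarrow{\alpha}P_1'|P_2$ and $P_2|P_1\xrightarrow{\alpha}P_2|P_1'$. $\sim$ is strong bisimilarity for this transition system. -}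

module Defs where

open import Data.Nat using (ℕ)
open import Data.Product using (Σ; _×_; _,_; ∃)
open import Data.List.NonEmpty using (List⁺; _∷_)
open import Data.List using (List; []; _∷_)
open import Function.Bundles using (_↣_)

Countable : Set → Set
Countable A = A ↣ ℕ

data FProc (A : Set) : Set where
  𝟎   : FProc A
  _∙_ : A → FProc A → FProc A
  _∥_ : FProc A → FProc A → FProc A

-- Processes  P ::= F | !α.F | P|P .
-- A finite process is embedded via ⌜_⌝; since a finite parallel F|F is
-- literally a P|P, the constructors of Proc are 0, α.F, !α.F and P|P.
data Proc (A : Set) : Set where
  𝟎ₚ   : Proc A
  _∙ₚ_ : A → FProc A → Proc A
  !_∙_ : A → FProc A → Proc A
  _∣_  : Proc A → Proc A → Proc A

⌜_⌝ : ∀ {A} → FProc A → Proc A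
⌜ 𝟎 ⌝     = 𝟎ₚ
⌜ α ∙ F ⌝ = α ∙ₚ F
⌜ F ∥ G ⌝ = ⌜ F ⌝ ∣ ⌜ G ⌝

-- A finite process that is a parallel composition of k ≥ 1 prefixed finite
-- processes α₁.G₁ | ⋯ | αₖ.Gₖ, given by its list of components.
PrefixedPar : Set → Set
PrefixedPar A = List⁺ (Σ A (λ _ → FProc A))

bangList : ∀ {A} → Σ A (λ _ → FProc A) → List (Σ A (λ _ → FProc A)) → Proc A
bangList (α , G) []       = ! α ∙ G
bangList (α , G) (c ∷ cs) = (! α ∙ G) ∣ bangList c cs

bang : ∀ {A} → PrefixedPar A → Proc A
bang (c ∷ cs) = bangList c cs

data _─[_]→_ {A : Set} : Proc A → A → Proc A → Set where
  pre  : ∀ {α F} → (α ∙ₚ F) ─[ α ]→ ⌜ F ⌝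
  rep  : ∀ {α F} → (! α ∙ F) ─[ α ]→ ((! α ∙ F) ∣ ⌜ F ⌝)
  parL : ∀ {P₁ P₁' P₂ α} → P₁ ─[ α ]→ P₁' → (P₁ ∣ P₂) ─[ α ]→ (P₁' ∣ P₂)
  parR : ∀ {P₁ P₁' P₂ α} → P₁ ─[ α ]→ P₁' → (P₂ ∣ P₁) ─[ α ]→ (P₂ ∣ P₁')

IsBisimulation : ∀ {A} → (Proc A → Proc A → Set) → Set
IsBisimulation {A} R =
  (∀ {P Q} → R P Q → ∀ {α P'} → P ─[ α ]→ P' → ∃ λ Q' → (Q ─[ α ]→ Q') × R P' Q')
  × (∀ {P Q} → R P Q → ∀ {α Q'} → Q ─[ α ]→ Q' → ∃ λ P' → (P ─[ α ]→ P') × R P' Q')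

_∼_ : ∀ {A} → Proc A → Proc A → Set₁
P ∼ Q = ∃ λ (R : _ → _ → Set) → IsBisimulation R × R P Q

-- A replicated process B
-- absorbs a copy of itself, B ∣ B ∼ B, because every move of B leaves B in
-- place next to some residue.  Terminating parts cancel: if P ∣ Z ∼ Q ∣ Z
-- and Z has no infinite run, then P ∼ Q, since a move of P that the other
-- side answers inside Z can be replayed by the Z on the left, and so on,
-- until Q answers itself.  Now
--   (!F₁ ∣ !F₂) ∣ F₁' ≅ !F₂ ∣ (!F₁ ∣ F₁') ∼ (!F₂ ∣ !F₂) ∣ F₂' ∼ !F₂ ∣ F₂' ∼ !F₁ ∣ F₁',
-- so cancelling F₁' gives !F₁ ∣ !F₂ ∼ !F₁, and symmetrically !F₂ ∣ !F₁ ∼ !F₂.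
module Submission where

open import Defs
open import Data.List using ([]; _∷_)
open import Data.List.NonEmpty using (_∷_)
open import Data.Product using (Σ; _×_; _,_; ∃; -,_)
open import Function using (flip)
open import Induction.WellFounded using (Acc; acc)
open import Level using (0ℓ; suc)
open import Relation.Binary.Bundles using (Setoid)
open import Relation.Binary.Structures using (IsEquivalence)
open import Relation.Binary.Construct.Composition using (_;_)
import Relation.Binary.Reasoning.Setoid as ∼-Reasoning

private
  variable
    A : Set
    α : A
    B B₁ B₂ P P' Q Q' R W W' Z Z₁ Z₂ : Proc A

Rel : Set → Set₁
Rel A = Proc A → Proc A → Set

Simulation : Rel A → Set
Simulation ℛ = ∀ {P Q} → ℛ P Q → ∀ {α P'} → P ─[ α ]→ P' → ∃ λ Q' → (Q ─[ α ]→ Q') × ℛ P' Q'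

simulations⇒bisimulation : {ℛ : Rel A} → Simulation ℛ → Simulation (flip ℛ) → IsBisimulation ℛ
simulations⇒bisimulation sim sim⁻¹ = (λ r t → sim r t) , (λ r t → sim⁻¹ r t)

bisimulation⇒simulation⁻¹ : {ℛ : Rel A} → IsBisimulation ℛ → Simulation (flip ℛ)
bisimulation⇒simulation⁻¹ (_ , sim⁻¹) r t = sim⁻¹ r t

-- Stated without a symmetry rule, so that it is a simulation by a single
-- induction; symmetry is derived.
infix 4 _≅_
data _≅_ {A : Set} : Rel A where
  ≅-refl        : P ≅ P
  ≅-trans       : P ≅ Q → Q ≅ R → P ≅ R
  ∣-comm        : (P ∣ Q) ≅ (Q ∣ P)
  ∣-assoc       : ((P ∣ Q) ∣ R) ≅ (P ∣ (Q ∣ R))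
  ∣-assoc⁻¹     : (P ∣ (Q ∣ R)) ≅ ((P ∣ Q) ∣ R)
  ∣-congˡ       : P ≅ P' → (P ∣ Q) ≅ (P' ∣ Q)
  ∣-congʳ       : Q ≅ Q' → (P ∣ Q) ≅ (P ∣ Q')
  ∣-identityʳ   : (P ∣ 𝟎ₚ) ≅ P
  ∣-identityʳ⁻¹ : P ≅ (P ∣ 𝟎ₚ)

≅-sym : P ≅ Q → Q ≅ P
≅-sym ≅-refl          = ≅-refl
≅-sym (≅-trans e f)   = ≅-trans (≅-sym f) (≅-sym e)
≅-sym ∣-comm          = ∣-comm
≅-sym ∣-assoc         = ∣-assoc⁻¹
≅-sym ∣-assoc⁻¹       = ∣-assoc
≅-sym (∣-congˡ e)     = ∣-congˡ (≅-sym e)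
≅-sym (∣-congʳ e)     = ∣-congʳ (≅-sym e)
≅-sym ∣-identityʳ     = ∣-identityʳ⁻¹
≅-sym ∣-identityʳ⁻¹   = ∣-identityʳ

≅-simulation : Simulation (_≅_ {A})
≅-simulation ≅-refl t = -, t , ≅-refl
≅-simulation (≅-trans e f) t with ≅-simulation e t
... | _ , u , e' with ≅-simulation f u
...   | _ , v , f' = -, v , ≅-trans e' f'
≅-simulation ∣-comm (parL t) = -, parR t , ∣-comm
≅-simulation ∣-comm (parR t) = -, parL t , ∣-comm
≅-simulation ∣-assoc (parL (parL t)) = -, parL t , ∣-assoc
≅-simulation ∣-assoc (parL (parR t)) = -, parR (parL t) , ∣-assoc
≅-simulation ∣-assoc (parR t)        = -, parR (parR t) , ∣-assoc
≅-simulation ∣-assoc⁻¹ (parL t)        = -, parL (parL t) , ∣-assoc⁻¹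
≅-simulation ∣-assoc⁻¹ (parR (parL t)) = -, parL (parR t) , ∣-assoc⁻¹
≅-simulation ∣-assoc⁻¹ (parR (parR t)) = -, parR t , ∣-assoc⁻¹
≅-simulation (∣-congˡ e) (parL t) with ≅-simulation e t
... | _ , u , e' = -, parL u , ∣-congˡ e'
≅-simulation (∣-congˡ e) (parR t) = -, parR t , ∣-congˡ e
≅-simulation (∣-congʳ e) (parL t) = -, parL t , ∣-congʳ e
≅-simulation (∣-congʳ e) (parR t) with ≅-simulation e t
... | _ , u , e' = -, parR u , ∣-congʳ e'
≅-simulation ∣-identityʳ (parL t) = -, t , ∣-identityʳ
≅-simulation ∣-identityʳ⁻¹ t = -, parL t , ∣-identityʳ⁻¹

≅-simulation⁻¹ : Simulation (flip (_≅_ {A}))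
≅-simulation⁻¹ e t = let _ , u , e' = ≅-simulation (≅-sym e) t in -, u , ≅-sym e'

≅-isBisimulation : IsBisimulation (_≅_ {A})
≅-isBisimulation = simulations⇒bisimulation ≅-simulation ≅-simulation⁻¹

≅⇒∼ : P ≅ Q → P ∼ Q
≅⇒∼ e = _≅_ , ≅-isBisimulation , e

∼-refl : P ∼ P
∼-refl = ≅⇒∼ ≅-refl

∼-sym : P ∼ Q → Q ∼ P
∼-sym (ℛ , (sim , sim⁻¹) , r) = flip ℛ , (sim⁻¹ , sim) , r

simulation-; : {ℛ 𝒮 : Rel A} → Simulation ℛ → Simulation 𝒮 → Simulation (ℛ ; 𝒮)
simulation-; simℛ sim𝒮 (_ , r , s) t with simℛ r t
... | _ , u , r' with sim𝒮 s u
...   | _ , v , s' = -, v , (-, r' , s')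

∼-trans : P ∼ Q → Q ∼ R → P ∼ R
∼-trans {Q = Q} (ℛ , bℛ@(simℛ , _) , r) (𝒮 , b𝒮@(sim𝒮 , _) , s) =
  ℛ ; 𝒮 , simulations⇒bisimulation (simulation-; simℛ sim𝒮) sim⁻¹ , (Q , r , s)
  where
  sim⁻¹ : Simulation (flip (ℛ ; 𝒮))
  sim⁻¹ (M , r , s) t =
    let _ , u , (M' , s' , r') = simulation-; (bisimulation⇒simulation⁻¹ b𝒮) (bisimulation⇒simulation⁻¹ bℛ) (M , s , r) t
    in -, u , (M' , r' , s')

∼-isEquivalence : IsEquivalence (_∼_ {A})
∼-isEquivalence = record { refl = ∼-refl ; sym = ∼-sym ; trans = ∼-trans }

∼-setoid : Set → Setoid 0ℓ (suc 0ℓ)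
∼-setoid A = record { Carrier = Proc A ; _≈_ = _∼_ ; isEquivalence = ∼-isEquivalence }

data LeftOfPar (ℛ : Rel A) : Rel A where
  _∣-   : ℛ P Q → LeftOfPar ℛ (P ∣ Z) (Q ∣ Z)

leftOfPar-flip : {ℛ : Rel A} → LeftOfPar ℛ P Q → LeftOfPar (flip ℛ) Q P
leftOfPar-flip (r ∣-) = r ∣-

leftOfPar-simulation : {ℛ : Rel A} → Simulation ℛ → Simulation (LeftOfPar ℛ)
leftOfPar-simulation sim (r ∣-) (parL t) with sim r t
... | _ , u , r' = -, parL u , r' ∣-
leftOfPar-simulation sim (r ∣-) (parR t) = -, parR t , r ∣-

∼-congˡ : P ∼ Q → (P ∣ Z) ∼ (Q ∣ Z)
∼-congˡ (ℛ , bℛ@(sim , _) , r) =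
  LeftOfPar ℛ , simulations⇒bisimulation (leftOfPar-simulation sim) sim⁻¹' , r ∣-
  where
  sim⁻¹' : Simulation (flip (LeftOfPar ℛ))
  sim⁻¹' c t =
    let _ , u , c' = leftOfPar-simulation (bisimulation⇒simulation⁻¹ bℛ) (leftOfPar-flip c) t
    in -, u , leftOfPar-flip c'

∼-congʳ : P ∼ Q → (Z ∣ P) ∼ (Z ∣ Q)
∼-congʳ p = ∼-trans (≅⇒∼ ∣-comm) (∼-trans (∼-congˡ p) (≅⇒∼ ∣-comm))

Replicating : Proc A → Set
Replicating B = ∀ {α B'} → B ─[ α ]→ B' → ∃ λ G → B' ≅ (B ∣ G)

bangList-replicating : ∀ (c : Σ A (λ _ → FProc A)) cs → Replicating (bangList c cs)
bangList-replicating _ []       rep        = -, ≅-refl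
bangList-replicating _ (_ ∷ _)  (parL rep) = -, ≅-trans ∣-assoc (≅-trans (∣-congʳ ∣-comm) ∣-assoc⁻¹)
bangList-replicating _ (c ∷ cs) (parR t) =
  let _ , e = bangList-replicating c cs t in -, ≅-trans (∣-congʳ e) ∣-assoc⁻¹

bang-replicating : (F : PrefixedPar A) → Replicating (bang F)
bang-replicating (c ∷ cs) = bangList-replicating c cs

replicating⇒∣-idem : Replicating B → (B ∣ B) ∼ B
replicating⇒∣-idem {B = B} replicates =
  Doubled , simulations⇒bisimulation sim sim⁻¹ , (𝟎ₚ , ∣-identityʳ⁻¹ , ∣-identityʳ⁻¹)
  where
  Doubled : Rel _
  Doubled X Y = ∃ λ Z → X ≅ ((B ∣ B) ∣ Z) × Y ≅ (B ∣ Z)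

  left : ∀ {B' G Z} → B' ≅ (B ∣ G) → ((B' ∣ B) ∣ Z) ≅ ((B ∣ B) ∣ (G ∣ Z))
  left e = ≅-trans (∣-congˡ (∣-congˡ e)) (≅-trans (∣-congˡ ∣-assoc)
             (≅-trans (∣-congˡ (∣-congʳ ∣-comm)) (≅-trans (∣-congˡ ∣-assoc⁻¹) ∣-assoc)))

  right : ∀ {B' G Z} → B' ≅ (B ∣ G) → ((B ∣ B') ∣ Z) ≅ ((B ∣ B) ∣ (G ∣ Z))
  right e = ≅-trans (∣-congˡ (∣-congʳ e)) (≅-trans (∣-congˡ ∣-assoc⁻¹) ∣-assoc)

  single : ∀ {B' G Z} → B' ≅ (B ∣ G) → (B' ∣ Z) ≅ (B ∣ (G ∣ Z))
  single e = ≅-trans (∣-congˡ e) ∣-assoc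

  sim : Simulation Doubled
  sim (Z , ex , ey) t with ≅-simulation ex t
  ... | _ , parL (parL u) , ex' with replicates u | ≅-simulation⁻¹ ey (parL u)
  ...   | _ , e | _ , v , ey' = -, v , (-, ≅-trans ex' (left e) , ≅-trans ey' (single e))
  sim (Z , ex , ey) t | _ , parL (parR u) , ex' with replicates u | ≅-simulation⁻¹ ey (parL u)
  ...   | _ , e | _ , v , ey' = -, v , (-, ≅-trans ex' (right e) , ≅-trans ey' (single e))
  sim (Z , ex , ey) t | _ , parR u , ex' with ≅-simulation⁻¹ ey (parR u)
  ...   | _ , v , ey' = -, v , (-, ex' , ey')

  sim⁻¹ : Simulation (flip Doubled)
  sim⁻¹ (Z , ex , ey) t with ≅-simulation ey t
  ... | _ , parL u , ey' with replicates u | ≅-simulation⁻¹ ex (parL (parL u))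
  ...   | _ , e | _ , v , ex' = -, v , (-, ≅-trans ex' (left e) , ≅-trans ey' (single e))
  sim⁻¹ (Z , ex , ey) t | _ , parR u , ey' with ≅-simulation⁻¹ ex (parR u)
  ...   | _ , v , ex' = -, v , (-, ex' , ey')

_⟵_ : Rel A
P' ⟵ P = ∃ λ α → P ─[ α ]→ P'

Terminating : Proc A → Set
Terminating = Acc _⟵_

∣-terminating : Terminating P → Terminating Q → Terminating (P ∣ Q)
∣-terminating (acc p) (acc q) = acc λ where
  (_ , parL t) → ∣-terminating (p (-, t)) (acc q)
  (_ , parR t) → ∣-terminating (acc p) (q (-, t))

⌜⌝-terminating : (F : FProc A) → Terminating ⌜ F ⌝
⌜⌝-terminating 𝟎       = acc λ ()
⌜⌝-terminating (_ ∙ F) = acc λ where (_ , pre) → ⌜⌝-terminating F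
⌜⌝-terminating (F ∥ G) = ∣-terminating (⌜⌝-terminating F) (⌜⌝-terminating G)

Cancelled : Rel A → Rel A
Cancelled ℛ P Q = ∃ λ Z → Terminating Z × ℛ (P ∣ Z) (Q ∣ Z)

module _ {ℛ : Rel A} (sim : Simulation ℛ) where

  -- The right side answered by W ─[ α ]→ W' instead of moving Q; the left
  -- side replays that move, which can recur only finitely often.
  replay : Terminating W' → ℛ (P ∣ W) (Q ∣ W') → W ─[ α ]→ W' →
           ∃ λ Q' → (Q ─[ α ]→ Q') × Cancelled ℛ P Q'
  replay (acc next) r t with sim r (parR t)
  ... | _ , parL u , r' = -, u , (-, acc next , r')
  ... | _ , parR u , r' = replay (next (-, u)) r' u

  cancelled-simulation : Simulation (Cancelled ℛ)
  cancelled-simulation (Z , acc next , r) t with sim r (parL t)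
  ... | _ , parL u , r' = -, u , (Z , acc next , r')
  ... | _ , parR u , r' = replay (next (-, u)) r' u

∼-cancelʳ : Terminating Z → (P ∣ Z) ∼ (Q ∣ Z) → P ∼ Q
∼-cancelʳ tZ (ℛ , bℛ@(sim , _) , r) =
  Cancelled ℛ ,
  simulations⇒bisimulation (cancelled-simulation sim)
                           (cancelled-simulation (bisimulation⇒simulation⁻¹ bℛ)) ,
  (-, tZ , r)

∣-absorbʳ : Replicating B₂ → Terminating Z₁ → (B₁ ∣ Z₁) ∼ (B₂ ∣ Z₂) → (B₁ ∣ B₂) ∼ B₁
∣-absorbʳ {B₂ = B₂} {Z₁ = Z₁} {B₁ = B₁} {Z₂ = Z₂} replicates tZ₁ h = ∼-cancelʳ tZ₁ (begin
  (B₁ ∣ B₂) ∣ Z₁  ≈⟨ ≅⇒∼ (≅-trans (∣-congˡ ∣-comm) ∣-assoc) ⟩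
  B₂ ∣ (B₁ ∣ Z₁)  ≈⟨ ∼-congʳ h ⟩
  B₂ ∣ (B₂ ∣ Z₂)  ≈⟨ ≅⇒∼ ∣-assoc⁻¹ ⟩
  (B₂ ∣ B₂) ∣ Z₂  ≈⟨ ∼-congˡ (replicating⇒∣-idem replicates) ⟩
  B₂ ∣ Z₂         ≈⟨ h ⟨
  B₁ ∣ Z₁         ∎)
  where open ∼-Reasoning (∼-setoid _)

lemma5 : ∀ {A : Set} → Countable A →
    (F₁ F₂ : PrefixedPar A) (F₁' F₂' : FProc A) →
    (bang F₁ ∣ ⌜ F₁' ⌝) ∼ (bang F₂ ∣ ⌜ F₂' ⌝) →
    bang F₁ ∼ bang F₂
lemma5 _ F₁ F₂ F₁' F₂' h = begin
  bang F₁            ≈⟨ ∣-absorbʳ (bang-replicating F₂) (⌜⌝-terminating F₁') h ⟨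
  bang F₁ ∣ bang F₂  ≈⟨ ≅⇒∼ ∣-comm ⟩
  bang F₂ ∣ bang F₁  ≈⟨ ∣-absorbʳ (bang-replicating F₁) (⌜⌝-terminating F₂') (∼-sym h) ⟩
  bang F₂            ∎
  where open ∼-Reasoning (∼-setoid _)
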